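{- Let $\mathcal{A}$ be a partial combinatory algebra in which $\bar 0,\bar 1$ are separable. Then there exists $b\in\mathcal{A}$ that has no total extension in $\mathcal{A}$.
   Context: A pca $\mathcal{A}$ is a set with a partial, left-associative, strict application that is combinatory complete; equivalently it has $k,s$ with $kab=a$, $sab\downarrow$, $sabc\simeq ac(bc)$. With combinatory abstraction $\lambda^*$, put $i=skk$, $\mathsf{false}=ki$, $\langle a,b\rangle=\lambda^*z.zab$, numerals $\bar 0=i$, $\bar 1=\langle\mathsf{false},\bar 0\rangle$. An element $f$ is total if $fa$ is defined for every $a$. $\bar 0,\bar 1$ are separable in $\mathcal{A}$ if there is a total $c\in\mathcal{A}$ with $ca\in\{\bar 0,\bar 1\}$ for all $a$ such that $ca=\bar 0\Rightarrow a\ne\bar 1$ and $ca=\bar 1\Rightarrow a\neq\bar 0$. For $b,f\in\mathcal{A}$, $f$ is a total extension of $b$ if $f$ is total and $ba\downarrow$ implies $fa=ba$ for every $a\in\mathcal{A}$. -}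

module Defs where

open import Data.Product using (Σ; Σ-syntax; _×_; _,_)
open import Data.Sum using (_⊎_)
open import Relation.Binary.PropositionalEquality using (_≡_)
open import Relation.Nullary using (¬_)
open import Function.Bundles using (_⇔_)

data Term (A : Set) : Set where
  con  : A → Term A
  _∙_  : Term A → Term A → Term A
infixl 9 _∙_

-- Terms with one free variable (for combinatory abstraction λ*).
data Term₁ (A : Set) : Set where
  var  : Term₁ A
  con  : Term A → Term₁ A
  _∙_  : Term₁ A → Term₁ A → Term₁ A

-- Evaluation of terms w.r.t. a partial application given as a
-- (functional) relation  App a b c  meaning  "a·b is defined and equals c".
data _⊢_⇓_ {A : Set} (App : A → A → A → Set) : Term A → A → Set where
  ⇓con : ∀ {a} → App ⊢ con a ⇓ a
  ⇓app : ∀ {t u f x y} → App ⊢ t ⇓ f → App ⊢ u ⇓ x → App f x y → App ⊢ (t ∙ u) ⇓ y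

record PCA : Set₁ where
  field
    Carrier : Set
    App     : Carrier → Carrier → Carrier → Set
    App-functional : ∀ {a b c c'} → App a b c → App a b c' → c ≡ c'
    k s : Carrier
    k-ax : ∀ a b → App ⊢ (con k ∙ con a ∙ con b) ⇓ a
    s-def : ∀ a b → Σ[ v ∈ Carrier ] (App ⊢ (con s ∙ con a ∙ con b) ⇓ v)
    -- s a b c ≃ a c (b c)   (Kleene equality)
    s-ax : ∀ a b c v →
      (App ⊢ (con s ∙ con a ∙ con b ∙ con c) ⇓ v) ⇔ (App ⊢ (con a ∙ con c ∙ (con b ∙ con c)) ⇓ v)

module PCANotation (𝒜 : PCA) where
  open PCA 𝒜

  _⇓_ : Term Carrier → Carrier → Set
  t ⇓ v = App ⊢ t ⇓ v

  K S I : Term Carrier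
  K = con k
  S = con s
  I = S ∙ K ∙ K

  λ* : Term₁ Carrier → Term Carrier
  λ* var       = I
  λ* (con t)   = K ∙ t
  λ* (t ∙ u)   = S ∙ λ* t ∙ λ* u

  false : Term Carrier
  false = K ∙ I

  pair : Term Carrier → Term Carrier → Term Carrier
  pair a b = λ* (var ∙ con a ∙ con b)

  num0 num1 : Term Carrier
  num0 = I
  num1 = pair false num0

  Total : Carrier → Set
  Total f = ∀ a → Σ[ v ∈ Carrier ] App f a v

  Separable01 : Set
  Separable01 = Σ[ c ∈ Carrier ]
      Total c
    × (∀ a → Σ[ v ∈ Carrier ] (App c a v × (num0 ⇓ v ⊎ num1 ⇓ v)))
    × (∀ a v → App c a v → num0 ⇓ v → ¬ (num1 ⇓ a))
    × (∀ a v → App c a v → num1 ⇓ v → ¬ (num0 ⇓ a))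

  TotalExtension : Carrier → Carrier → Set
  TotalExtension f b = Total f × (∀ a v → App b a v → App f a v)

module Submission where

-- A diagonal argument.  Let c separate 0̄ and 1̄.  Put
--
--     b  =  λ*x. c (x x) 1̄ ,
--
-- and observe that applying a numeral to 1̄ swaps the two numerals:
-- 0̄ 1̄ = 1̄ (as 0̄ = i) and 1̄ 1̄ = 1̄ false 0̄ = false false 0̄ = 0̄.
-- If f were a total extension of b, then y = f f would satisfy
-- y = b f = c y 1̄, which is 1̄ when c y = 0̄ and 0̄ when c y = 1̄;
-- either way c misclassifies y, contradicting separation.

open import Defs
open import Data.Product using (Σ; Σ-syntax; _×_; _,_; proj₁; proj₂)
open import Data.Sum using (_⊎_; inj₁; inj₂)
open import Data.Empty using (⊥)
open import Relation.Nullary using (¬_)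
open import Relation.Binary.PropositionalEquality using (_≡_; refl; subst)
open import Function.Bundles using (Equivalence)

module Combinators (𝒜 : PCA) where
  open PCA 𝒜
  open PCANotation 𝒜

  eval-deterministic : ∀ {t v w} → t ⇓ v → t ⇓ w → v ≡ w
  eval-deterministic ⇓con ⇓con = refl
  eval-deterministic (⇓app t⇓f u⇓x fx) (⇓app t⇓f' u⇓x' fx')
    with eval-deterministic t⇓f t⇓f' | eval-deterministic u⇓x u⇓x'
  ... | refl | refl = App-functional fx fx'

  k-partial : ∀ a b → Σ[ g ∈ Carrier ] (App k a g × App g b a)
  k-partial a b with k-ax a b
  ... | ⇓app (⇓app ⇓con ⇓con ka) ⇓con kab = _ , ka , kab

  k₁ : Carrier → Carrier
  k₁ a = proj₁ (k-partial a a)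

  k₁-app : ∀ a → App k a (k₁ a)
  k₁-app a = proj₁ (proj₂ (k-partial a a))

  k-reduces : ∀ a b → App (k₁ a) b a
  k-reduces a b with k-partial a b
  ... | g , ka , gb = subst (λ h → App h b a) (App-functional ka (k₁-app a)) gb

  s-partial : ∀ a b → Σ[ g ∈ Carrier ] Σ[ h ∈ Carrier ] (App s a g × App g b h)
  s-partial a b with s-def a b
  ... | _ , ⇓app (⇓app ⇓con ⇓con sa) ⇓con sab = _ , _ , sa , sab

  s₁ : Carrier → Carrier
  s₁ a = proj₁ (s-partial a a)

  s₁-app : ∀ a → App s a (s₁ a)
  s₁-app a = proj₁ (proj₂ (proj₂ (s-partial a a)))

  s₂ : Carrier → Carrier → Carrier
  s₂ a b = proj₁ (proj₂ (s-partial a b))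

  s₂-app : ∀ a b → App (s₁ a) b (s₂ a b)
  s₂-app a b = subst (λ g → App g b (s₂ a b)) (App-functional sa (s₁-app a)) gb
    where
    sa : App s a (proj₁ (s-partial a b))
    sa = proj₁ (proj₂ (proj₂ (s-partial a b)))
    gb : App (proj₁ (s-partial a b)) b (s₂ a b)
    gb = proj₂ (proj₂ (proj₂ (s-partial a b)))

  s₂-eval : ∀ a b → (S ∙ con a ∙ con b) ⇓ s₂ a b
  s₂-eval a b = ⇓app (⇓app ⇓con ⇓con (s₁-app a)) ⇓con (s₂-app a b)

  s-reduces : ∀ {a b c x y v} → App a c x → App b c y → App x y v → App (s₂ a b) c v
  s-reduces {a} {b} {c} {x} {y} {v} ac bc xy
    with Equivalence.from (s-ax a b c v) (⇓app (⇓app ⇓con ⇓con ac) (⇓app ⇓con ⇓con bc) xy)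
  ... | ⇓app sab⇓ ⇓con r = subst (λ g → App g c v) (eval-deterministic sab⇓ (s₂-eval a b)) r

  i : Carrier
  i = s₂ k k

  i-reduces : ∀ x → App i x x
  i-reduces x = s-reduces (k₁-app x) (k₁-app x) (k-reduces x (k₁ x))

module Numerals (𝒜 : PCA) where
  open PCA 𝒜
  open PCANotation 𝒜
  open Combinators 𝒜

  -- The values of false = k i and of 1̄ = λ*z. z false 0̄ = s (s i (k false)) (k 0̄);
  -- note that k 0̄ = k i is again false.
  false-val one : Carrier
  false-val = k₁ i
  one = s₂ (s₂ i (k₁ false-val)) false-val

  zero-eval : num0 ⇓ i
  zero-eval = s₂-eval k k

  false-eval : false ⇓ false-val
  false-eval = ⇓app ⇓con zero-eval (k₁-app i)

  one-eval : num1 ⇓ one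
  one-eval = ⇓app (⇓app ⇓con s-i-kfalse (s₁-app _)) false-eval (s₂-app _ false-val)
    where
    s-i-kfalse : (S ∙ I ∙ (K ∙ false)) ⇓ s₂ i (k₁ false-val)
    s-i-kfalse = ⇓app (⇓app ⇓con zero-eval (s₁-app i)) (⇓app ⇓con false-eval (k₁-app false-val))
                      (s₂-app i (k₁ false-val))

  one-reduces : ∀ {P x r} → App P false-val x → App x i r → App one P r
  one-reduces {P} Pf xi = s-reduces (s-reduces (i-reduces P) (k-reduces false-val P) Pf)
                                    (k-reduces i P) xi

  zero-swaps : App i one one
  zero-swaps = i-reduces one

  one-swaps : App one one i
  one-swaps = one-reduces (one-reduces (k-reduces i false-val) (i-reduces i)) (i-reduces i)

module Diagonal (𝒜 : PCA) where
  open PCA 𝒜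
  open PCANotation 𝒜
  open Combinators 𝒜
  open Numerals 𝒜

  -- The diagonal element  diag c = λ*x. c (x x) 1̄.
  diag : Carrier → Carrier
  diag c = s₂ (s₂ (k₁ c) (s₂ i i)) (k₁ one)

  diag-reduces : ∀ {c x y d e} → App x x y → App c y d → App d one e → App (diag c) x e
  diag-reduces {c} {x} xx cy de =
    s-reduces (s-reduces (k-reduces c x) (s-reduces (i-reduces x) (i-reduces x) xx) cy)
              (k-reduces one x) de

  self-application-fixed : ∀ {c f y d e} → TotalExtension f (diag c) →
    App f f y → App c y d → App d one e → e ≡ y
  self-application-fixed {f = f} (_ , extends) ff cy de =
    App-functional (extends f _ (diag-reduces ff cy de)) ff

  diag-no-total-extension : ((c , _ , _ , _ , _) : Separable01) →
    ∀ f → ¬ TotalExtension f (diag c)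
  diag-no-total-extension (c , _ , classify , not-one , not-zero) f ext@(f-total , _) =
    refute (classify y)
    where
    y : Carrier
    y = proj₁ (f-total f)
    ff : App f f y
    ff = proj₂ (f-total f)
    -- c y is 0̄ or 1̄; in each case y = c y 1̄ is the other numeral.
    refute : Σ[ d ∈ Carrier ] (App c y d × (num0 ⇓ d ⊎ num1 ⇓ d)) → ⊥
    refute (d , cy , inj₁ d-zero) with eval-deterministic d-zero zero-eval
    ... | refl = not-one y i cy d-zero
                   (subst (num1 ⇓_) (self-application-fixed ext ff cy zero-swaps) one-eval)
    refute (d , cy , inj₂ d-one) with eval-deterministic d-one one-eval
    ... | refl = not-zero y one cy d-one
                   (subst (num0 ⇓_) (self-application-fixed ext ff cy one-swaps) zero-eval)

theorem8p3 : (𝒜 : PCA) → PCANotation.Separable01 𝒜 →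
    Σ[ b ∈ PCA.Carrier 𝒜 ] ¬ (Σ[ f ∈ PCA.Carrier 𝒜 ] PCANotation.TotalExtension 𝒜 f b)
theorem8p3 𝒜 sep@(c , _) = diag c , λ (f , ext) → diag-no-total-extension sep f ext
  where open Diagonal 𝒜
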